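{- Let $G$ be a simple undirected graph on $n$ vertices that is not regular. Then $\sigma_{t}(G)\geq n-1$ if $n$ is odd, and $\sigma_{t}(G)\geq 2n-4$ if $n$ is even.
   Context: For a finite simple graph $G$ with $d(v)$ the degree of $v$, $\sigma_{t}(G)=\sum_{\{u,v\}\subseteq V(G)}(d(u)-d(v))^{2}$, summing over all unordered pairs of distinct vertices. -}

module Defs where

open import Data.Nat using (ℕ; zero; suc)
open import Data.Bool using (Bool; true; false)
open import Data.Fin using (Fin; _<_)
open import Data.Fin.Properties using (_<?_)
open import Data.List using (List; map; allFin)
open import Data.Nat.ListAction using (sum)
open import Data.Integer using (ℤ; +_; _-_; _*_; _+_)
open import Data.List using (foldr)
open import Relation.Binary.PropositionalEquality using (_≡_)
open import Relation.Nullary using (¬_; yes; no)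

record SimpleGraph (n : ℕ) : Set where
  field
    adj     : Fin n → Fin n → Bool
    symm    : ∀ i j → adj i j ≡ adj j i
    irrefl  : ∀ i → adj i i ≡ false

open SimpleGraph public

b2n : Bool → ℕ
b2n true  = 1
b2n false = 0

degree : ∀ {n} → SimpleGraph n → Fin n → ℕ
degree {n} G v = sum (map (λ u → b2n (adj G v u)) (allFin n))

Regular : ∀ {n} → SimpleGraph n → Set
Regular {n} G = ∀ (u v : Fin n) → degree G u ≡ degree G v

sumℤ : List ℤ → ℤ
sumℤ = foldr _+_ (+ 0)

sq : ℤ → ℤ
sq x = x * x

pairSum : ∀ {n} → (Fin n → Fin n → ℤ) → ℤ
pairSum {n} f = sumℤ (map (λ i → sumℤ (map (λ j → g i j) (allFin n))) (allFin n))
  where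
  g : Fin n → Fin n → ℤ
  g i j with i <? j
  ... | yes _ = f i j
  ... | no  _ = + 0

sigmaT : ∀ {n} → SimpleGraph n → ℤ
sigmaT G = pairSum (λ u v → sq (+ degree G u - + degree G v))

{-# OPTIONS --safe #-}
-- Only two properties of the degree sequence d are used: it is not constant,
-- and its sum is even. Let σ = Σ_{i<j} (d i - d j)², and for a value c let k
-- be its multiplicity in d and r = Σ_j (c - d j)². The ordered pairs (i, j)
-- with exactly one of d i, d j equal to c give 2 k r ≤ 2 σ, and every j with
-- d j ≠ c adds at least 1 to r, so n ≤ k + r. Hence if a ≤ k and k + a ≤ n
-- then a ≤ r, and (k - a)(r - a) ≥ 0 gives a n ≤ a² + σ.
-- With a = 1 and c = d u this is σ ≥ n - 1, for every n. For a = 2 it gives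
-- σ ≥ 2n - 4 as soon as some multiplicity lies in [2, n - 2]. If all values
-- are distinct, summing n ≤ 1 + r over the n values gives n² ≤ n + 2σ, which
-- again suffices. Otherwise n - 1 entries equal some c and one equals c′;
-- then σ ≥ (n - 1)(c - c′)², which suffices unless c′ = c ± 1, and then for
-- even n the sum (n - 1) c + c′ is odd.
module Submission where

open import Defs
open import Data.Empty using (⊥-elim)
open import Data.Fin.Base using (Fin; zero; suc)
open import Data.Fin.Properties as Fin using (any?; ¬∀⟶∃¬)
open import Data.Integer as ℤ using (ℤ; _⊖_)
import Data.Integer.Properties as ℤ
open import Data.List.Base as List using (map; allFin; tabulate)
open import Data.List.Properties using (map-tabulate)
open import Data.Nat.Base
open import Data.Nat.Divisibility
  using (_∣_; ∣m⇒∣m*n; ∣m+n∣m⇒∣n; ∣1⇒≡1; m∣m*n; m%n≡0⇒n∣m)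
open import Data.Nat.Properties
open import Algebra.Properties.Semiring.Sum +-*-semiring
  using (sum; sum-syntax; sum-cong-≗; sum-remove; ∑-distrib-+; ∑-comm; *-distribˡ-sum; *-distribʳ-sum)
open import Data.Nat.Tactic.RingSolver using (solve-∀)
open import Data.Product using (_×_; _,_; proj₂; ∃; ∃₂)
open import Data.Sum using (_⊎_; inj₁; inj₂)
open import Data.Vec.Functional as Vector using ()
open import Function using (id; _∘_)
open import Relation.Binary.PropositionalEquality
open import Relation.Nullary using (¬_; yes; no)

∑-mono-≤ : ∀ {n} {f g : Fin n → ℕ} → (∀ i → f i ≤ g i) → sum f ≤ sum g
∑-mono-≤ {zero}  f≤g = z≤n
∑-mono-≤ {suc n} f≤g = +-mono-≤ (f≤g zero) (∑-mono-≤ (f≤g ∘ suc))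

∑-mono-≤-≡⇒≗ : ∀ {n} {f g : Fin n → ℕ} →
  (∀ i → f i ≤ g i) → sum f ≡ sum g → ∀ i → f i ≡ g i
∑-mono-≤-≡⇒≗ {suc n} {f} {g} f≤g ∑f≡∑g = λ where
    zero    → ≤-antisym (f≤g zero) (+-cancelʳ-≤ (sum (f ∘ suc)) _ _ g₀+∑f′≤f₀+∑f′)
    (suc i) → ∑-mono-≤-≡⇒≗ (f≤g ∘ suc) (≤-antisym ∑f′≤∑g′ ∑g′≤∑f′) i
  where
  ∑f′≤∑g′ : sum (f ∘ suc) ≤ sum (g ∘ suc)
  ∑f′≤∑g′ = ∑-mono-≤ (f≤g ∘ suc)
  g₀+∑f′≤f₀+∑f′ : g zero + sum (f ∘ suc) ≤ f zero + sum (f ∘ suc)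
  g₀+∑f′≤f₀+∑f′ = ≤-trans (+-monoʳ-≤ (g zero) ∑f′≤∑g′) (≤-reflexive (sym ∑f≡∑g))
  ∑g′≤∑f′ : sum (g ∘ suc) ≤ sum (f ∘ suc)
  ∑g′≤∑f′ = +-cancelˡ-≤ (g zero) _ _
    (≤-trans (≤-reflexive (sym ∑f≡∑g)) (+-monoˡ-≤ (sum (f ∘ suc)) (f≤g zero)))

∑-const : ∀ n c → ∑[ i < n ] c ≡ n * c
∑-const zero    c = refl
∑-const (suc n) c = cong (c +_) (∑-const n c)

term≤∑ : ∀ {n} (f : Fin n → ℕ) i → f i ≤ sum f
term≤∑ {suc n} f i = ≤-trans (m≤m+n (f i) _) (≤-reflexive (sym (sum-remove {i = i} f)))

upper : ∀ {n} → (Fin n → Fin n → ℕ) → Fin n → Fin n → ℕ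
upper F i j with i Fin.<? j
... | yes _ = F i j
... | no  _ = 0

upper+upperᵀ : ∀ {n} (F : Fin n → Fin n → ℕ) →
  (∀ i j → F i j ≡ F j i) → (∀ i → F i i ≡ 0) → ∀ i j → F i j ≡ upper F i j + upper F j i
upper+upperᵀ F F-sym F-diag i j with i Fin.<? j | j Fin.<? i
... | yes i<j | yes j<i = ⊥-elim (Fin.<-asym i<j j<i)
... | yes _   | no  _   = sym (+-identityʳ _)
... | no  _   | yes _   = F-sym i j
... | no  i≮j | no  j≮i = trans (cong (F i) (Fin.≤-antisym (≮⇒≥ i≮j) (≮⇒≥ j≮i))) (F-diag i)

∑∑-symmetric : ∀ {n} (F : Fin n → Fin n → ℕ) → (∀ i j → F i j ≡ F j i) → (∀ i → F i i ≡ 0) →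
  ∑[ i < n ] ∑[ j < n ] F i j ≡ 2 * ∑[ i < n ] ∑[ j < n ] upper F i j
∑∑-symmetric {n} F F-sym F-diag = begin
  ∑[ i < n ] ∑[ j < n ] F i j
    ≡⟨ sum-cong-≗ (λ i → sum-cong-≗ (upper+upperᵀ F F-sym F-diag i)) ⟩
  ∑[ i < n ] ∑[ j < n ] (upper F i j + upper F j i)
    ≡⟨ sum-cong-≗ (λ i → ∑-distrib-+ (upper F i) (λ j → upper F j i)) ⟩
  ∑[ i < n ] (∑[ j < n ] upper F i j + ∑[ j < n ] upper F j i)
    ≡⟨ ∑-distrib-+ (λ i → ∑[ j < n ] upper F i j) (λ i → ∑[ j < n ] upper F j i) ⟩
  U + ∑[ i < n ] ∑[ j < n ] upper F j i
    ≡⟨ cong (U +_) (∑-comm (λ i j → upper F j i)) ⟩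
  U + U
    ≡⟨ cong (U +_) (+-identityʳ U) ⟨
  2 * U ∎
  where
  open ≡-Reasoning
  U : ℕ
  U = ∑[ i < n ] ∑[ j < n ] upper F i j

a*[m+n]≤a*a+m*n : ∀ {a m n} → a ≤ m → a ≤ n → a * (m + n) ≤ a * a + m * n
a*[m+n]≤a*a+m*n {a} a≤m a≤n with m≤n⇒∃[o]m+o≡n a≤m | m≤n⇒∃[o]m+o≡n a≤n
... | x , refl | y , refl = ≤-trans (m≤m+n _ (x * y)) (≤-reflexive (expand a x y))
  where
  expand : ∀ a x y → a * ((a + x) + (a + y)) + x * y ≡ a * a + (a + x) * (a + y)
  expand = solve-∀

a*n≤a*a+k*r : ∀ {a k r n} → a ≤ k → k + a ≤ n → n ≤ k + r → a * n ≤ a * a + k * r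
a*n≤a*a+k*r {a} {k} {r} a≤k k+a≤n n≤k+r = ≤-trans (*-monoʳ-≤ a n≤k+r)
  (a*[m+n]≤a*a+m*n a≤k (+-cancelˡ-≤ k a r (≤-trans k+a≤n n≤k+r)))

5*m≤8+m*m : ∀ m → 5 * m ≤ 8 + m * m
5*m≤8+m*m 0 = ≤ᵇ⇒≤ _ _ _
5*m≤8+m*m 1 = ≤ᵇ⇒≤ _ _ _
5*m≤8+m*m 2 = ≤ᵇ⇒≤ _ _ _
5*m≤8+m*m 3 = ≤ᵇ⇒≤ _ _ _
5*m≤8+m*m 4 = ≤ᵇ⇒≤ _ _ _
5*m≤8+m*m m@(suc (suc (suc (suc (suc _))))) =
  ≤-trans (*-monoˡ-≤ m (≤ᵇ⇒≤ 5 m _)) (m≤n+m (m * m) 8)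

m*m≤m+2t⇒2m≤4+t : ∀ {m t} → m * m ≤ m + 2 * t → 2 * m ≤ 4 + t
m*m≤m+2t⇒2m≤4+t {m} {t} m*m≤m+2t = *-cancelˡ-≤ 2 (+-cancelʳ-≤ m _ _ (begin
  2 * (2 * m) + m   ≡⟨ lhs m ⟩
  5 * m             ≤⟨ 5*m≤8+m*m m ⟩
  8 + m * m         ≤⟨ +-monoʳ-≤ 8 m*m≤m+2t ⟩
  8 + (m + 2 * t)   ≡⟨ rhs m t ⟩
  2 * (4 + t) + m   ∎))
  where
  open ≤-Reasoning
  lhs : ∀ m → 2 * (2 * m) + m ≡ 5 * m
  lhs = solve-∀
  rhs : ∀ m t → 8 + (m + 2 * t) ≡ 2 * (4 + t) + m
  rhs = solve-∀

Consecutive : ℕ → ℕ → Set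
Consecutive a b = b ≡ suc a ⊎ a ≡ suc b

2∤1 : ¬ 2 ∣ 1
2∤1 = (λ ()) ∘ ∣1⇒≡1

-- k c + c′ = (k + 1) c ± 1.
2∣k+1⇒2∤k*c+c′ : ∀ {k c c′} → 2 ∣ k + 1 → Consecutive c c′ → ¬ 2 ∣ k * c + c′
2∣k+1⇒2∤k*c+c′ {k} {c} 2∣k+1 (inj₁ refl) 2∣k*c+c′ =
  2∤1 (∣m+n∣m⇒∣n (subst (2 ∣_) (shift k c) 2∣k*c+c′) (∣m⇒∣m*n c 2∣k+1))
  where
  shift : ∀ k c → k * c + suc c ≡ (k + 1) * c + 1
  shift = solve-∀
2∣k+1⇒2∤k*c+c′ {k} {_} {c′} 2∣k+1 (inj₂ refl) 2∣k*c+c′ =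
  2∤1 (∣m+n∣m⇒∣n 2∣k+1 (∣m+n∣m⇒∣n (subst (2 ∣_) (shift k c′) 2∣k*c+c′) (∣m⇒∣m*n c′ 2∣k+1)))
  where
  shift : ∀ k c′ → k * suc c′ + c′ ≡ (k + 1) * c′ + k
  shift = solve-∀

sqDist : ℕ → ℕ → ℕ
sqDist a b = ∣ a - b ∣ * ∣ a - b ∣

sqDist-comm : ∀ a b → sqDist a b ≡ sqDist b a
sqDist-comm a b = cong (λ x → x * x) (∣-∣-comm a b)

sqDist-self : ∀ a → sqDist a a ≡ 0
sqDist-self a = cong (λ x → x * x) (∣n-n∣≡0 a)

≢⇒1≤sqDist : ∀ {a b} → a ≢ b → 1 ≤ sqDist a b
≢⇒1≤sqDist {a} {b} a≢b = *-mono-≤ 1≤∣a-b∣ 1≤∣a-b∣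
  where
  1≤∣a-b∣ : 1 ≤ ∣ a - b ∣
  1≤∣a-b∣ = n≢0⇒n>0 (a≢b ∘ ∣m-n∣≡0⇒m≡n)

≢⇒4≤sqDist⊎consecutive : ∀ {a b} → a ≢ b → 4 ≤ sqDist a b ⊎ Consecutive a b
≢⇒4≤sqDist⊎consecutive {zero}        {zero}        a≢b = ⊥-elim (a≢b refl)
≢⇒4≤sqDist⊎consecutive {zero}        {suc zero}    _   = inj₂ (inj₁ refl)
≢⇒4≤sqDist⊎consecutive {suc zero}    {zero}        _   = inj₂ (inj₂ refl)
≢⇒4≤sqDist⊎consecutive {zero}        {suc (suc b)} _   = inj₁ (*-mono-≤ (m≤m+n 2 b) (m≤m+n 2 b))
≢⇒4≤sqDist⊎consecutive {suc (suc a)} {zero}        _   = inj₁ (*-mono-≤ (m≤m+n 2 a) (m≤m+n 2 a))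
≢⇒4≤sqDist⊎consecutive {suc a}       {suc b}       a≢b
  with ≢⇒4≤sqDist⊎consecutive (a≢b ∘ cong suc)
... | inj₁ 4≤s        = inj₁ 4≤s
... | inj₂ (inj₁ b≡a) = inj₂ (inj₁ (cong suc b≡a))
... | inj₂ (inj₂ a≡b) = inj₂ (inj₂ (cong suc a≡b))

δ : ℕ → ℕ → ℕ
δ x c with x ≟ c
... | yes _ = 1
... | no  _ = 0

δ-refl : ∀ x → δ x x ≡ 1
δ-refl x with x ≟ x
... | yes _   = refl
... | no  x≢x = ⊥-elim (x≢x refl)

δ+δ≤1 : ∀ {a b} x → a ≢ b → δ x a + δ x b ≤ 1
δ+δ≤1 {a} {b} x a≢b with x ≟ a | x ≟ b
... | yes refl | yes refl = ⊥-elim (a≢b refl)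
... | yes _    | no  _    = ≤-refl
... | no  _    | yes _    = ≤-refl
... | no  _    | no  _    = z≤n

δ+δ≡1⇒two-valued : ∀ {a b} x → a ≢ b → δ x a + δ x b ≡ 1 → x ≡ δ x a * a + δ x b * b
δ+δ≡1⇒two-valued {a} {b} x a≢b _ with x ≟ a | x ≟ b
... | yes refl | yes refl = ⊥-elim (a≢b refl)
... | yes refl | no  _    = sym (trans (+-identityʳ _) (+-identityʳ x))
... | no  _    | yes refl = sym (+-identityʳ x)
δ+δ≡1⇒two-valued x a≢b () | no _ | no _

1≤sqDist+δ : ∀ c y → 1 ≤ sqDist c y + δ y c
1≤sqDist+δ c y with y ≟ c
... | yes _   = m≤n+m 1 _
... | no  y≢c = ≤-trans (≢⇒1≤sqDist (y≢c ∘ sym)) (m≤m+n _ 0)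

δ*sqDist≤sqDist : ∀ x y c → δ x c * sqDist c y + δ y c * sqDist x c ≤ sqDist x y
δ*sqDist≤sqDist x y c with x ≟ c | y ≟ c
... | yes refl | yes refl rewrite sqDist-self x = z≤n
... | yes refl | no  _    = ≤-reflexive (trans (+-identityʳ _) (+-identityʳ _))
... | no  _    | yes refl = ≤-reflexive (+-identityʳ _)
... | no  _    | no  _    = z≤n

module _ {n : ℕ} (d : Fin n → ℕ) where

  σ : ℕ
  σ = ∑[ i < n ] ∑[ j < n ] upper (λ i j → sqDist (d i) (d j)) i j

  multiplicity : ℕ → ℕ
  multiplicity c = ∑[ j < n ] δ (d j) c

  deviation : ℕ → ℕ
  deviation c = ∑[ j < n ] sqDist c (d j)

  ∑deviation≡2σ : ∑[ i < n ] deviation (d i) ≡ 2 * σ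
  ∑deviation≡2σ = ∑∑-symmetric _ (λ i j → sqDist-comm (d i) (d j)) (sqDist-self ∘ d)

  ∑∑δ*sqDist≡multiplicity*deviation : ∀ c →
    ∑[ i < n ] ∑[ j < n ] (δ (d i) c * sqDist c (d j)) ≡ multiplicity c * deviation c
  ∑∑δ*sqDist≡multiplicity*deviation c = begin
    ∑[ i < n ] ∑[ j < n ] (δ (d i) c * sqDist c (d j))
      ≡⟨ sum-cong-≗ (λ i → *-distribˡ-sum (δ (d i) c) (sqDist c ∘ d)) ⟨
    ∑[ i < n ] (δ (d i) c * deviation c)
      ≡⟨ *-distribʳ-sum (deviation c) (λ i → δ (d i) c) ⟨
    multiplicity c * deviation c ∎
    where open ≡-Reasoning

  multiplicity*deviation≤σ : ∀ c → multiplicity c * deviation c ≤ σ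
  multiplicity*deviation≤σ c = *-cancelˡ-≤ 2 (begin
    2 * kr
      ≡⟨ cong (kr +_) (+-identityʳ kr) ⟩
    kr + kr
      ≡⟨ cong₂ _+_ (∑∑δ*sqDist≡multiplicity*deviation c) transposed ⟨
    ∑[ i < n ] ∑[ j < n ] A i j + ∑[ i < n ] ∑[ j < n ] B i j
      ≡⟨ ∑-distrib-+ (λ i → ∑[ j < n ] A i j) (λ i → ∑[ j < n ] B i j) ⟨
    ∑[ i < n ] (∑[ j < n ] A i j + ∑[ j < n ] B i j)
      ≡⟨ sum-cong-≗ (λ i → ∑-distrib-+ (A i) (B i)) ⟨
    ∑[ i < n ] ∑[ j < n ] (A i j + B i j)
      ≤⟨ ∑-mono-≤ (λ i → ∑-mono-≤ (λ j → δ*sqDist≤sqDist (d i) (d j) c)) ⟩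
    ∑[ i < n ] deviation (d i)
      ≡⟨ ∑deviation≡2σ ⟩
    2 * σ ∎)
    where
    open ≤-Reasoning
    kr : ℕ
    kr = multiplicity c * deviation c
    A B : Fin n → Fin n → ℕ
    A i j = δ (d i) c * sqDist c (d j)
    B i j = δ (d j) c * sqDist (d i) c
    transposed : ∑[ i < n ] ∑[ j < n ] B i j ≡ kr
    transposed = trans (∑-comm B) (trans
      (sum-cong-≗ (λ j → sum-cong-≗ (λ i → cong (δ (d j) c *_) (sqDist-comm (d i) c))))
      (∑∑δ*sqDist≡multiplicity*deviation c))

  n≡∑1 : n ≡ ∑[ j < n ] 1
  n≡∑1 = sym (trans (∑-const n 1) (*-identityʳ n))

  n≤multiplicity+deviation : ∀ c → n ≤ multiplicity c + deviation c
  n≤multiplicity+deviation c = begin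
    n                                         ≡⟨ n≡∑1 ⟩
    ∑[ j < n ] 1                              ≤⟨ ∑-mono-≤ (λ j → 1≤sqDist+δ c (d j)) ⟩
    ∑[ j < n ] (sqDist c (d j) + δ (d j) c)   ≡⟨ ∑-distrib-+ (sqDist c ∘ d) (λ j → δ (d j) c) ⟩
    deviation c + multiplicity c              ≡⟨ +-comm (deviation c) _ ⟩
    multiplicity c + deviation c              ∎
    where open ≤-Reasoning

  1≤multiplicity : ∀ u → 1 ≤ multiplicity (d u)
  1≤multiplicity u =
    subst (_≤ multiplicity (d u)) (δ-refl (d u)) (term≤∑ (λ j → δ (d j) (d u)) u)

  multiplicity+multiplicity≤n : ∀ {a b} → a ≢ b → multiplicity a + multiplicity b ≤ n
  multiplicity+multiplicity≤n {a} {b} a≢b = begin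
    multiplicity a + multiplicity b      ≡⟨ ∑-distrib-+ (λ j → δ (d j) a) (λ j → δ (d j) b) ⟨
    ∑[ j < n ] (δ (d j) a + δ (d j) b)   ≤⟨ ∑-mono-≤ (λ j → δ+δ≤1 (d j) a≢b) ⟩
    ∑[ j < n ] 1                         ≡⟨ n≡∑1 ⟨
    n                                    ∎
    where open ≤-Reasoning

  multiplicity+1≤n : ∀ {c v} → c ≢ d v → multiplicity c + 1 ≤ n
  multiplicity+1≤n {c} {v} c≢dv =
    ≤-trans (+-monoʳ-≤ (multiplicity c) (1≤multiplicity v)) (multiplicity+multiplicity≤n c≢dv)

  ∑-two-valued : ∀ {a b} → a ≢ b → multiplicity a + multiplicity b ≡ n →
    sum d ≡ multiplicity a * a + multiplicity b * b
  ∑-two-valued {a} {b} a≢b ka+kb≡n = begin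
    sum d
      ≡⟨ sum-cong-≗ (λ j → δ+δ≡1⇒two-valued (d j) a≢b (δa+δb≡1 j)) ⟩
    ∑[ j < n ] (δ (d j) a * a + δ (d j) b * b)
      ≡⟨ ∑-distrib-+ (λ j → δ (d j) a * a) (λ j → δ (d j) b * b) ⟩
    ∑[ j < n ] (δ (d j) a * a) + ∑[ j < n ] (δ (d j) b * b)
      ≡⟨ cong₂ _+_ (*-distribʳ-sum a (λ j → δ (d j) a)) (*-distribʳ-sum b (λ j → δ (d j) b)) ⟨
    multiplicity a * a + multiplicity b * b ∎
    where
    open ≡-Reasoning
    δa+δb≡1 : ∀ j → δ (d j) a + δ (d j) b ≡ 1
    δa+δb≡1 = ∑-mono-≤-≡⇒≗ (λ j → δ+δ≤1 (d j) a≢b)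
      (trans (∑-distrib-+ (λ j → δ (d j) a) (λ j → δ (d j) b)) (trans ka+kb≡n n≡∑1))

  a*n≤a*a+σ : ∀ {a} c → a ≤ multiplicity c → multiplicity c + a ≤ n → a * n ≤ a * a + σ
  a*n≤a*a+σ c a≤k k+a≤n = ≤-trans (a*n≤a*a+k*r a≤k k+a≤n (n≤multiplicity+deviation c))
    (+-monoʳ-≤ _ (multiplicity*deviation≤σ c))

  nonconstant⇒n≤1+σ : ∀ {u v} → d u ≢ d v → n ≤ 1 + σ
  nonconstant⇒n≤1+σ {u} du≢dv = subst (_≤ 1 + σ) (*-identityˡ n)
    (a*n≤a*a+σ (d u) (1≤multiplicity u) (multiplicity+1≤n du≢dv))

  nonconstant⇒∃≢ : ∀ {u v} → d u ≢ d v → ∀ w → ∃ λ x → d w ≢ d x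
  nonconstant⇒∃≢ {u} {v} du≢dv w with d w ≟ d u
  ... | yes dw≡du = v , du≢dv ∘ trans (sym dw≡du)
  ... | no  dw≢du = u , dw≢du

  almost-constant-∑ : ∀ {w x} → d w ≢ d x → n ≤ multiplicity (d w) + 1 →
    n ≡ multiplicity (d w) + 1 × sum d ≡ multiplicity (d w) * d w + d x
  almost-constant-∑ {w} {x} dw≢dx n≤k+1 = n≡k+1 , ∑d≡k*c+c′
    where
    k k′ : ℕ
    k  = multiplicity (d w)
    k′ = multiplicity (d x)
    k+1≤k+k′ : k + 1 ≤ k + k′
    k+1≤k+k′ = +-monoʳ-≤ k (1≤multiplicity x)
    k+k′≤n : k + k′ ≤ n
    k+k′≤n = multiplicity+multiplicity≤n dw≢dx
    n≡k+1 : n ≡ k + 1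
    n≡k+1 = ≤-antisym n≤k+1 (≤-trans k+1≤k+k′ k+k′≤n)
    k′≡1 : k′ ≡ 1
    k′≡1 = +-cancelˡ-≡ k _ _ (≤-antisym (≤-trans k+k′≤n n≤k+1) k+1≤k+k′)
    ∑d≡k*c+c′ : sum d ≡ k * d w + d x
    ∑d≡k*c+c′ = begin
      sum d                 ≡⟨ ∑-two-valued dw≢dx (trans (cong (k +_) k′≡1) (sym n≡k+1)) ⟩
      k * d w + k′ * d x    ≡⟨ cong (λ m → k * d w + m * d x) k′≡1 ⟩
      k * d w + 1 * d x     ≡⟨ cong (k * d w +_) (*-identityˡ (d x)) ⟩
      k * d w + d x         ∎
      where open ≡-Reasoning

  almost-constant⇒2n≤4+σ : ∀ {w x} → d w ≢ d x → n ≤ multiplicity (d w) + 1 →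
    2 ∣ n → 2 ∣ sum d → 2 * n ≤ 4 + σ
  almost-constant⇒2n≤4+σ {w} {x} dw≢dx n≤k+1 2∣n 2∣∑d with ≢⇒4≤sqDist⊎consecutive dw≢dx
  ... | inj₁ 4≤s = begin
    2 * n                     ≤⟨ *-monoʳ-≤ 2 n≤k+1 ⟩
    2 * (k + 1)               ≤⟨ *-monoˡ-≤ (k + 1) (≤ᵇ⇒≤ 2 4 _) ⟩
    4 * (k + 1)               ≡⟨ 4*[k+1]≡4+k*4 k ⟩
    4 + k * 4                 ≤⟨ +-monoʳ-≤ 4 (*-monoʳ-≤ k 4≤r) ⟩
    4 + k * deviation (d w)   ≤⟨ +-monoʳ-≤ 4 (multiplicity*deviation≤σ (d w)) ⟩
    4 + σ                     ∎
    where
    open ≤-Reasoning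
    k : ℕ
    k = multiplicity (d w)
    4≤r : 4 ≤ deviation (d w)
    4≤r = ≤-trans 4≤s (term≤∑ (sqDist (d w) ∘ d) x)
    4*[k+1]≡4+k*4 : ∀ k → 4 * (k + 1) ≡ 4 + k * 4
    4*[k+1]≡4+k*4 = solve-∀
  ... | inj₂ consecutive with almost-constant-∑ dw≢dx n≤k+1
  ...   | n≡k+1 , ∑d≡k*c+c′ = ⊥-elim
    (2∣k+1⇒2∤k*c+c′ (subst (2 ∣_) n≡k+1 2∣n) consecutive (subst (2 ∣_) ∑d≡k*c+c′ 2∣∑d))

  injective⇒2n≤4+σ : (∀ w → multiplicity (d w) ≤ 1) → 2 * n ≤ 4 + σ
  injective⇒2n≤4+σ k≤1 = m*m≤m+2t⇒2m≤4+t {n} {σ} (begin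
    n * n
      ≡⟨ ∑-const n n ⟨
    ∑[ w < n ] n
      ≤⟨ ∑-mono-≤ (λ w → n≤multiplicity+deviation (d w)) ⟩
    ∑[ w < n ] (multiplicity (d w) + deviation (d w))
      ≤⟨ ∑-mono-≤ (λ w → +-monoˡ-≤ (deviation (d w)) (k≤1 w)) ⟩
    ∑[ w < n ] (1 + deviation (d w))
      ≡⟨ ∑-distrib-+ (λ _ → 1) (deviation ∘ d) ⟩
    ∑[ w < n ] 1 + ∑[ w < n ] deviation (d w)
      ≡⟨ cong₂ _+_ (sym n≡∑1) ∑deviation≡2σ ⟩
    n + 2 * σ ∎)
    where open ≤-Reasoning

  nonconstant⇒2n≤4+σ : ∀ {u v} → d u ≢ d v → 2 ∣ n → 2 ∣ sum d → 2 * n ≤ 4 + σ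
  nonconstant⇒2n≤4+σ du≢dv 2∣n 2∣∑d with any? (λ w → n ≤? multiplicity (d w) + 1)
  ... | yes (w , n≤k+1) =
    almost-constant⇒2n≤4+σ (proj₂ (nonconstant⇒∃≢ du≢dv w)) n≤k+1 2∣n 2∣∑d
  ... | no ¬almost with any? (λ w → 2 ≤? multiplicity (d w))
  ...   | yes (w , 2≤k) =
    a*n≤a*a+σ (d w) 2≤k (subst (_≤ n) (sym (+-suc _ 1)) (≰⇒> (¬almost ∘ (w ,_))))
  ...   | no ¬repeated = injective⇒2n≤4+σ (λ w → ≤-pred (≰⇒> (¬repeated ∘ (w ,_))))

¬∀≡⇒∃≢ : ∀ {n} (f : Fin n → ℕ) → ¬ (∀ u v → f u ≡ f v) → ∃₂ λ u v → f u ≢ f v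
¬∀≡⇒∃≢ {n} f ¬const with ¬∀⟶∃¬ n _ (λ u → Fin.all? (λ v → f u ≟ f v)) ¬const
... | u , ¬∀v with ¬∀⟶∃¬ n _ (λ v → f u ≟ f v) ¬∀v
...   | v , fu≢fv = u , v , fu≢fv

foldr-map-allFin : ∀ {A : Set} (_∙_ : A → A → A) (e : A) {n} (h : Fin n → A) →
  List.foldr _∙_ e (map h (allFin n)) ≡ Vector.foldr _∙_ e h
foldr-map-allFin _∙_ e h =
  trans (cong (List.foldr _∙_ e) (map-tabulate id h)) (foldr-tabulate h)
  where
  foldr-tabulate : ∀ {m} (g : Fin m → _) → List.foldr _∙_ e (tabulate g) ≡ Vector.foldr _∙_ e g
  foldr-tabulate {zero}  g = refl
  foldr-tabulate {suc m} g = cong (g zero ∙_) (foldr-tabulate (g ∘ suc))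

degree≡∑adj : ∀ {n} (G : SimpleGraph n) v → degree G v ≡ ∑[ u < n ] b2n (adj G v u)
degree≡∑adj G v = foldr-map-allFin _+_ 0 (λ u → b2n (adj G v u))

2∣∑degree : ∀ {n} (G : SimpleGraph n) → 2 ∣ sum (degree G)
2∣∑degree {n} G = subst (2 ∣_) (sym ∑degree≡2*edges) (m∣m*n edges)
  where
  edges : ℕ
  edges = ∑[ i < n ] ∑[ j < n ] upper (λ i j → b2n (adj G i j)) i j
  ∑degree≡2*edges : sum (degree G) ≡ 2 * edges
  ∑degree≡2*edges = trans (sum-cong-≗ (degree≡∑adj G))
    (∑∑-symmetric _ (λ i j → cong b2n (symm G i j)) (λ i → cong b2n (irrefl G i)))

sumℤ-pos : ∀ {n} (h : Fin n → ℤ) (f : Fin n → ℕ) → (∀ i → h i ≡ ℤ.+ f i) →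
  sumℤ (map h (allFin n)) ≡ ℤ.+ sum f
sumℤ-pos h f h≡f = trans (foldr-map-allFin ℤ._+_ (ℤ.+ 0) h) (foldr-pos h f h≡f)
  where
  foldr-pos : ∀ {m} (h : Fin m → ℤ) (f : Fin m → ℕ) → (∀ i → h i ≡ ℤ.+ f i) →
    Vector.foldr ℤ._+_ (ℤ.+ 0) h ≡ ℤ.+ sum f
  foldr-pos {zero}  h f h≡f = refl
  foldr-pos {suc m} h f h≡f = trans
    (cong₂ ℤ._+_ (h≡f zero) (foldr-pos (h ∘ suc) (f ∘ suc) (h≡f ∘ suc)))
    (sym (ℤ.pos-+ (f zero) _))

-- The summand of `pairSum` is local to its `where` block; here it is the
-- solution `g` of the unification problem posed by `refl`.
pairSum-summand : ∀ {n} (f : Fin n → Fin n → ℤ) (F : Fin n → Fin n → ℕ) →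
  (∀ i j → f i j ≡ ℤ.+ F i j) → ∀ i j →
  (λ (g : Fin n → Fin n → ℤ)
     (_ : pairSum f ≡ sumℤ (map (λ i → sumℤ (map (g i) (allFin n))) (allFin n))) →
     g i j ≡ ℤ.+ upper F i j) _ refl
pairSum-summand f F f≡F i j with i Fin.<? j
... | yes _ = f≡F i j
... | no  _ = refl

pairSum-pos : ∀ {n} (f : Fin n → Fin n → ℤ) (F : Fin n → Fin n → ℕ) →
  (∀ i j → f i j ≡ ℤ.+ F i j) → pairSum f ≡ ℤ.+ ∑[ i < n ] ∑[ j < n ] upper F i j
pairSum-pos f F f≡F = sumℤ-pos _ _ λ i → sumℤ-pos _ _ (pairSum-summand f F f≡F i)

∣m⊖n∣≡∣m-n∣ : ∀ m n → ℤ.∣ m ⊖ n ∣ ≡ ∣ m - n ∣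
∣m⊖n∣≡∣m-n∣ zero    zero    = refl
∣m⊖n∣≡∣m-n∣ zero    (suc n) = refl
∣m⊖n∣≡∣m-n∣ (suc m) zero    = refl
∣m⊖n∣≡∣m-n∣ (suc m) (suc n) =
  trans (cong ℤ.∣_∣ (ℤ.[1+m]⊖[1+n]≡m⊖n m n)) (∣m⊖n∣≡∣m-n∣ m n)

sq≡∣∣*∣∣ : ∀ i → sq i ≡ ℤ.+ (ℤ.∣ i ∣ * ℤ.∣ i ∣)
sq≡∣∣*∣∣ (ℤ.+ k)      = ℤ.+◃n≡+n (k * k)
sq≡∣∣*∣∣ (ℤ.-[1+ k ]) = ℤ.+◃n≡+n _

sq[+a-+b]≡sqDist : ∀ a b → sq (ℤ.+ a ℤ.- ℤ.+ b) ≡ ℤ.+ sqDist a b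
sq[+a-+b]≡sqDist a b =
  trans (sq≡∣∣*∣∣ (ℤ.+ a ℤ.- ℤ.+ b)) (cong (λ x → ℤ.+ (x * x)) ∣+a-+b∣≡∣a-b∣)
  where
  ∣+a-+b∣≡∣a-b∣ : ℤ.∣ ℤ.+ a ℤ.- ℤ.+ b ∣ ≡ ∣ a - b ∣
  ∣+a-+b∣≡∣a-b∣ = trans (cong ℤ.∣_∣ (ℤ.[+m]-[+n]≡m⊖n a b)) (∣m⊖n∣≡∣m-n∣ a b)

sigmaT≡σ : ∀ {n} (G : SimpleGraph n) → sigmaT G ≡ ℤ.+ σ (degree G)
sigmaT≡σ G = pairSum-pos _ _ (λ i j → sq[+a-+b]≡sqDist (degree G i) (degree G j))

m≤k+t⇒+m-+k≤+t : ∀ {m k t} → m ≤ k + t → ℤ.+ m ℤ.- ℤ.+ k ℤ.≤ ℤ.+ t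
m≤k+t⇒+m-+k≤+t {m} {k} {t} m≤k+t = begin
  ℤ.+ m ℤ.- ℤ.+ k          ≤⟨ ℤ.+-monoˡ-≤ (ℤ.- ℤ.+ k) (ℤ.+≤+ m≤k+t) ⟩
  ℤ.+ (k + t) ℤ.- ℤ.+ k    ≡⟨ ℤ.[+m]-[+n]≡m⊖n (k + t) k ⟩
  (k + t) ⊖ k              ≡⟨ ℤ.⊖-≥ (m≤m+n k t) ⟩
  ℤ.+ (k + t ∸ k)          ≡⟨ cong ℤ.+_ (m+n∸m≡n k t) ⟩
  ℤ.+ t                    ∎
  where open ℤ.≤-Reasoning

m≤k+σ⇒+m-+k≤sigmaT : ∀ {n m k} (G : SimpleGraph n) →
  m ≤ k + σ (degree G) → ℤ.+ m ℤ.- ℤ.+ k ℤ.≤ sigmaT G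
m≤k+σ⇒+m-+k≤sigmaT G m≤k+σ = subst (_ ℤ.≤_) (sym (sigmaT≡σ G)) (m≤k+t⇒+m-+k≤+t m≤k+σ)

theorem17 : (n : ℕ) (G : SimpleGraph n) → ¬ Regular G →
    (n % 2 ≡ 1 → ℤ.+ n ℤ.- ℤ.+ 1 ℤ.≤ sigmaT G) × (n % 2 ≡ 0 → ℤ.+ 2 ℤ.* ℤ.+ n ℤ.- ℤ.+ 4 ℤ.≤ sigmaT G)
theorem17 n G ¬regular with ¬∀≡⇒∃≢ (degree G) ¬regular
... | _ , _ , du≢dv =
    (λ _ → m≤k+σ⇒+m-+k≤sigmaT G n≤1+σ)
  , (λ n%2≡0 → subst (λ m → m ℤ.- ℤ.+ 4 ℤ.≤ sigmaT G) (ℤ.pos-* 2 n)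
                 (m≤k+σ⇒+m-+k≤sigmaT G (2n≤4+σ (m%n≡0⇒n∣m n 2 n%2≡0))))
  where
  n≤1+σ : n ≤ 1 + σ (degree G)
  n≤1+σ = nonconstant⇒n≤1+σ (degree G) du≢dv
  2n≤4+σ : 2 ∣ n → 2 * n ≤ 4 + σ (degree G)
  2n≤4+σ 2∣n = nonconstant⇒2n≤4+σ (degree G) du≢dv 2∣n (2∣∑degree G)
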